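{- Let $I$ be a concrete system and $\tilde I$ its abstraction with abstraction maps $h,h_A$ (as in the context). Let $\tilde\pi$ be a temporal path in $\tilde I$ starting at $\tilde s_1$ and ending at $\tilde s_n$. If $st_1\subseteq h^{ -1}(\tilde s_1)$ and $(\tilde\pi,st_1)\Rightarrow_t^*(\tilde s_n,st_n)$ for some $st_n$ with $\emptyset\subset st_n\subseteq S$, then there exists a concrete path that starts from a state in $st_1$ and ends in a state in $st_n$.
   Context: Concrete system $I$: agents $\Omega$; each agent $i$ has a finite set $\Phi_i$ of Boolean propositions (pairwise disjoint, $\Phi=\bigcup\Phi_i$); local states $L_i$ = valuations of $\Phi_i$; global states $S$ = tuples of local states (valuations of $\Phi$), $l_i(s)$ the $i$-component; initial states $S_0$. Finitely many actions $\alpha:\varepsilon\leftarrow\ell$, each owned by an agent $\mathbf{Ag}(\alpha)$, with guard $\ell$ a propositional formula over $\Phi$ and effect $\varepsilon$ a set of signed propositions $\pm p$. $\Theta_\alpha(st)=\{s[p\mapsto\top\mid+p\in\varepsilon][p\mapsto\bot\mid-p\in\varepsilon]: s\in st, s\models\ell\}$; the (asynchronous) transition $s\xrightarrow{\alpha}s'$ holds iff $\Theta_\alpha(\{s\})=\{s'\}$. Abstraction: for $\tilde\Phi\subseteq\Phi$, $\tilde\Phi_i=\tilde\Phi\cap\Phi_i$; local states are identified when they agree on $\tilde\Phi_i$, giving quotient maps $h_i$, abstract global states $\tilde S$, and $h(s)=(h_i(l_i(s)))_i$. Actions $\alpha,\alpha'$ are equivalent iff same owner, same effects restricted to $\tilde\Phi$,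 and $\exists(\Phi\setminus\tilde\Phi).\ell\equiv\exists(\Phi\setminus\tilde\Phi).\ell'$ (with $\exists x.f=f[\bot/x]\vee f[\top/x]$); $h_A(\alpha)=[\alpha]$ is the abstract action with effect $\{\pm p\in\varepsilon:p\in\tilde\Phi\}$ and guard $\exists(\Phi\setminus\tilde\Phi).\ell$; abstract transitions $\tilde s\xrightarrow{\tilde\alpha}\tilde s'$ are defined from these as in the concrete case; $\tilde S_0=h(S_0)$. A temporal path in $\tilde I$ is a finite sequence $\tilde s_1\xrightarrow{\tilde\alpha_2}\tilde s_2\dots\xrightarrow{\tilde\alpha_n}\tilde s_n$ of abstract transitions (a single state $\tilde s$ is the empty path); $\tilde s\xrightarrow{\tilde\alpha}\tilde s'\,\|\,\pi$ denotes the path whose first step is $\tilde s\xrightarrow{\tilde\alpha}\tilde s'$ followed by the path $\pi$ starting at $\tilde s'$. A concrete path is a sequence of concrete transitions. The rule $\Rightarrow_t$ on pairs (abstract path, set of concrete states): $(\tilde s\xrightarrow{\tilde\alpha}\tilde s'\,\|\,\pi,\ st)\Rightarrow_t(\pi,\ \bigcup_{\alpha\in h_A^{ -1}(\tilde\alpha)}\Theta_\alpha(st)\cap h^{ -1}(\tilde s'))$. $\Rightarrow_t^*$ denotes a finite sequence of $\Rightarrow_t$ steps. -}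

module Defs where

open import Data.Bool using (Bool; true; false; not; _∧_; _∨_; if_then_else_; T)
open import Data.Nat using (ℕ)
open import Data.Fin using (Fin; _≟_)
open import Data.Vec using (Vec; lookup; tabulate)
open import Data.List using (List; filterᵇ; allFin)
open import Data.Bool.ListAction using (any)
open import Data.List.Membership.Propositional using (_∈_)
open import Data.Product using (Σ; _×_; _,_; proj₁; proj₂; ∃)
open import Relation.Nullary.Decidable using (⌊_⌋)
open import Relation.Binary.PropositionalEquality using (_≡_)
open import Relation.Binary.Construct.Closure.ReflexiveTransitive using (Star)
open import Function.Bundles using (_⇔_)

data Formula (n : ℕ) : Set where
  var      : Fin n → Formula n
  tt ff    : Formula n
  ¬f_      : Formula n → Formula n
  _∧f_ _∨f_ : Formula n → Formula n → Formula n

-- global states = valuations of Φ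
State : ℕ → Set
State n = Vec Bool n

eval : ∀ {n} → State n → Formula n → Bool
eval s (var p)   = lookup s p
eval s tt        = true
eval s ff        = false
eval s (¬f f)    = not (eval s f)
eval s (f ∧f g)  = eval s f ∧ eval s g
eval s (f ∨f g)  = eval s f ∨ eval s g

subst : ∀ {n} → Fin n → Bool → Formula n → Formula n
subst x b (var p)  = if ⌊ x ≟ p ⌋ then (if b then tt else ff) else var p
subst x b tt       = tt
subst x b ff       = ff
subst x b (¬f f)   = ¬f subst x b f
subst x b (f ∧f g) = subst x b f ∧f subst x b g
subst x b (f ∨f g) = subst x b f ∨f subst x b g

exists : ∀ {n} → Fin n → Formula n → Formula n
exists x f = subst x false f ∨f subst x true f

existsList : ∀ {n} → List (Fin n) → Formula n → Formula n
existsList List.[] f = f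
existsList (x List.∷ xs) f = exists x (existsList xs f)

-- Signed propositions (true = +p, false = -p) and actions

Signed : ℕ → Set
Signed n = Bool × Fin n

record Action (m n : ℕ) : Set where
  constructor mkAction
  field
    owner  : Fin m
    effect : List (Signed n)
    guard  : Formula n

open Action public

applyEffect : ∀ {n} → List (Signed n) → State n → State n
applyEffect ε s = tabulate λ p →
  if any (λ sp → not (proj₁ sp) ∧ ⌊ proj₂ sp ≟ p ⌋) ε then false
  else if any (λ sp → proj₁ sp ∧ ⌊ proj₂ sp ≟ p ⌋) ε then true
  else lookup s p

StateSet : ℕ → Set₁
StateSet n = State n → Set

Θ : ∀ {m n} → Action m n → StateSet n → StateSet n
Θ α st s' = Σ (State _) λ s → st s × T (eval s (guard α)) × s' ≡ applyEffect (effect α) s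

Trans : ∀ {m n} → Action m n → State n → State n → Set
Trans α s s' = ∀ x → Θ α (λ y → y ≡ s) x ⇔ (x ≡ s')

record System : Set₁ where
  field
    nAg     : ℕ
    nProp   : ℕ
    agentOf : Fin nProp → Fin nAg     -- Φ_i = { p | agentOf p ≡ i } (pairwise disjoint, cover Φ)
    Init    : StateSet nProp
    nAct    : ℕ
    act     : Fin nAct → Action nAg nProp

open System public

data CPath (I : System) : State (nProp I) → State (nProp I) → Set where
  done : ∀ {s} → CPath I s s
  step : ∀ {s s' s''} (a : Fin (nAct I)) →
         Trans (act I a) s s' → CPath I s' s'' → CPath I s s''

-- Abstraction w.r.t. Φ̃ ⊆ Φ, given by its characteristic function `keep`.
-- An abstract global state (tuple of classes of local states, Φ_i partition Φ)
-- is represented canonically by the valuation that agrees on Φ̃ and is ⊥ off Φ̃.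

module Abstraction (I : System) (keep : Fin (nProp I) → Bool) where

  n = nProp I
  m = nAg I

  h : State n → State n
  h s = tabulate λ p → if keep p then lookup s p else false

  AbsState : State n → Set
  AbsState s̃ = h s̃ ≡ s̃

  hidden : List (Fin n)
  hidden = filterᵇ (λ p → not (keep p)) (allFin n)

  hideGuard : Formula n → Formula n
  hideGuard ℓ = existsList hidden ℓ

  restrictEff : List (Signed n) → List (Signed n)
  restrictEff ε = filterᵇ (λ sp → keep (proj₂ sp)) ε

  _~_ : Action m n → Action m n → Set
  α ~ α' = (owner α ≡ owner α')
         × (∀ sp → (sp ∈ restrictEff (effect α)) ⇔ (sp ∈ restrictEff (effect α')))
         × (∀ s → eval s (hideGuard (guard α)) ≡ eval s (hideGuard (guard α')))

  absAction : Action m n → Action m n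
  absAction α = mkAction (owner α) (restrictEff (effect α)) (hideGuard (guard α))

  -- abstract actions are represented by a concrete representative index a;
  -- α̃ = h_A(act a), and h_A⁻¹(α̃) = { b | act b ~ act a }
  AbsTrans : Fin (nAct I) → State n → State n → Set
  AbsTrans a s̃ s̃' = Trans (absAction (act I a)) s̃ s̃'

  data AbsPath : State n → State n → Set where
    empty : ∀ {s̃} → AbsPath s̃ s̃
    _⟶_∥_ : ∀ {s̃ s̃' s̃''} (a : Fin (nAct I)) →
            AbsTrans a s̃ s̃' → AbsPath s̃' s̃'' → AbsPath s̃ s̃''

  Config : State n → Set₁
  Config e = Σ (State n) (λ s̃ → AbsPath s̃ e) × StateSet n

  data _⇒t_ {e : State n} : Config e → Config e → Set₁ where
    rule : ∀ {s̃ s̃'} (a : Fin (nAct I)) (tr : AbsTrans a s̃ s̃') (π : AbsPath s̃' e)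
             (st : StateSet n) →
           ((s̃ , (a ⟶ tr ∥ π)) , st) ⇒t
           ((s̃' , π) , λ s' → (Σ (Fin (nAct I)) λ b → (act I b ~ act I a) × Θ (act I b) st s')
                              × h s' ≡ s̃')

  _⇒t*_ : {e : State n} → Config e → Config e → Set₁
  _⇒t*_ = Star _⇒t_

module Submission where

-- The rule ⇒t only ever shrinks the set of concrete states to
-- images Θ_b(st) of the current set under concrete actions b, so every state
-- of the set reached after k rule applications is the endpoint of a concrete
-- path starting in the original set st₁.

open import Defs
open import Data.Bool using (Bool; T)
open import Data.Fin using (Fin)
open import Data.Product using (Σ; _×_; _,_; proj₂)
open import Relation.Binary.PropositionalEquality using (_≡_; refl)
open import Relation.Binary.Construct.Closure.ReflexiveTransitive using (ε; _◅_)
open import Function.Bundles using (mk⇔)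

enabled⇒Trans : ∀ {m n} (α : Action m n) (s : State n) →
                T (eval s (guard α)) → Trans α s (applyEffect (effect α) s)
enabled⇒Trans α s enabled x = mk⇔ image⊆ ⊆image
  where
  image⊆ : Θ α (λ y → y ≡ s) x → x ≡ applyEffect (effect α) s
  image⊆ (_ , refl , _ , x≡ε[s]) = x≡ε[s]

  ⊆image : x ≡ applyEffect (effect α) s → Θ α (λ y → y ≡ s) x
  ⊆image x≡ε[s] = s , refl , enabled , x≡ε[s]

Θ-predecessor : ∀ {m n} (α : Action m n) (st : StateSet n) (s' : State n) →
                Θ α st s' → Σ (State n) λ s → st s × Trans α s s'
Θ-predecessor α st s' (s , s∈st , enabled , s'≡ε[s]) rewrite s'≡ε[s] =
  s , s∈st , enabled⇒Trans α s enabled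

module _ (I : System) (keep : Fin (nProp I) → Bool) where
  open Abstraction I keep

  ReachedFrom : StateSet (nProp I) → State (nProp I) → Set
  ReachedFrom st s' = Σ (State (nProp I)) λ s → st s × CPath I s s'

  ⇒t-predecessor : ∀ {e} {c c' : Config e} → c ⇒t c' →
                   ∀ s' → proj₂ c' s' → Σ (State (nProp I)) λ s → proj₂ c s ×
                     Σ (Fin (nAct I)) λ b → Trans (act I b) s s'
  ⇒t-predecessor (rule a _ _ st) s' ((b , _ , s'∈Θ) , _)
    with Θ-predecessor (act I b) st s' s'∈Θ
  ... | s , s∈st , s→s' = s , s∈st , b , s→s'

  ⇒t*-reached : ∀ {e} {c c' : Config e} → c ⇒t* c' →
                ∀ s' → proj₂ c' s' → ReachedFrom (proj₂ c) s'
  ⇒t*-reached ε s' s'∈c' = s' , s'∈c' , done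
  ⇒t*-reached (c⇒c₁ ◅ c₁⇒*c') s' s'∈c'
    with ⇒t*-reached c₁⇒*c' s' s'∈c'
  ... | s₁ , s₁∈c₁ , path with ⇒t-predecessor c⇒c₁ s₁ s₁∈c₁
  ...   | s , s∈c , b , s→s₁ = s , s∈c , step b s→s₁ path

proposition3 : (I : System) (keep : Fin (nProp I) → Bool)
    → let open Abstraction I keep in
    (s̃₁ s̃ₙ : State (nProp I)) → AbsState s̃₁ → (π̃ : AbsPath s̃₁ s̃ₙ)
    → (st₁ stₙ : StateSet (nProp I))
    → (∀ s → st₁ s → h s ≡ s̃₁)
    → (((s̃₁ , π̃) , st₁) ⇒t* ((s̃ₙ , empty) , stₙ))
    → Σ (State (nProp I)) (λ s → stₙ s)
    → Σ (State (nProp I)) λ s → Σ (State (nProp I)) λ s' → st₁ s × stₙ s' × CPath I s s'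
proposition3 I keep _ _ _ _ _ _ _ steps (s' , s'∈stₙ)
  with ⇒t*-reached I keep steps s' s'∈stₙ
... | s , s∈st₁ , path = s , s' , s∈st₁ , s'∈stₙ , path
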